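{- For every $\alpha>0$ and $k\in\mathbb{N}$ there exists $\gamma_0>0$ such that for every $0<\gamma\le\gamma_0$ there exists $n_0$ such that for all $n\ge n_0$ the following holds. Let $G$ be an oriented graph on $n$ vertices with $\Delta^0(G)\le d$, where $d\ge\alpha n$. Let $\mathcal{P}=\{V_{ij}:i,j\in[k]\}$ be a partition of $V(G)$ such that $|V_{i*}|\ge d/2$ for all $i\in[k]$, and suppose that for all $i,j\in[k]$, all but at most $\gamma n$ vertices $x\in V_{ij}$ satisfy $d^+(x,V_{*i})\ge d-\gamma n$ and $d^-(x,V_{j*})\ge d-\gamma n$. Let $I$ be (the vertex set of) a connected component of $S(\mathcal{P})$. Then $$\Big|\bigcup_{i\in I}(V_{i*}\cup V_{*i})\Big|\ge\begin{cases}2(d-\gamma n)&\text{if }|I|=1,\\ 9(d-5\gamma n)/4&\text{otherwise.}\end{cases}$$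
   Context: An oriented graph is a digraph with at most one edge between any two vertices. $\Delta^0(G)$ is the maximum over vertices of the larger of in- and outdegree. $V_{i*}=\bigcup_jV_{ij}$, $V_{*i}=\bigcup_jV_{ji}$; $d^{\pm}(x,S)$ = number of out/inneighbours of $x$ in $S$. $S(\mathcal{P})$ is the loopless undirected graph on $[k]$ in which distinct $i,j$ are adjacent iff $V_{ij}\cup V_{ji}\ne\emptyset$.
   Formalization: The parameters α and γ and the degree bound d take rational values. -}

module Defs where

open import Data.Nat using (ℕ; zero; suc)
open import Data.Bool using (Bool; true; false; _∧_; _∨_; not; if_then_else_)
open import Data.Fin using (Fin; zero; suc; _≟_)
open import Data.Product using (_×_; _,_; proj₁; proj₂; ∃-syntax)
open import Data.Sum using (_⊎_)
open import Data.Vec using (lookup)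
open import Data.Fin.Subset using (Subset; _∈_; Nonempty)
open import Relation.Nullary using (¬_)
open import Relation.Nullary.Decidable using (⌊_⌋)
open import Relation.Binary.PropositionalEquality using (_≡_)
open import Data.Integer using (+_)
open import Data.Rational using (ℚ; _/_; _≤_; _*_; _-_)

count : ∀ {n} → (Fin n → Bool) → ℕ
count {zero} p = zero
count {suc n} p = (if p zero then 1 else 0) Data.Nat.+ count (λ i → p (suc i))

ℕ→ℚ : ℕ → ℚ
ℕ→ℚ m = + m / 1

-- a digraph on vertex set Fin n, given by a Boolean edge relation E x y (edge x → y)
Digraph : ℕ → Set
Digraph n = Fin n → Fin n → Bool

Oriented : ∀ {n} → Digraph n → Set
Oriented {n} E = (∀ (x : Fin n) → E x x ≡ false)
               × (∀ (x y : Fin n) → E x y ≡ true → E y x ≡ false)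

outdeg : ∀ {n} → Digraph n → Fin n → ℕ
outdeg E x = count (λ y → E x y)

indeg : ∀ {n} → Digraph n → Fin n → ℕ
indeg E x = count (λ y → E y x)

MaxSemiDegreeAtMost : ∀ {n} → Digraph n → ℚ → Set
MaxSemiDegreeAtMost {n} E d =
  ∀ (x : Fin n) → (ℕ→ℚ (outdeg E x) ≤ d) × (ℕ→ℚ (indeg E x) ≤ d)

-- a partition P = {V_ij : i,j ∈ [k]} of V(G): each vertex x lies in V_ij where part x = (i , j)
Partition : ℕ → ℕ → Set
Partition n k = Fin n → Fin k × Fin k

inVij : ∀ {n k} → Partition n k → Fin k → Fin k → Fin n → Bool
inVij P i j x = ⌊ proj₁ (P x) ≟ i ⌋ ∧ ⌊ proj₂ (P x) ≟ j ⌋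

inVi* : ∀ {n k} → Partition n k → Fin k → Fin n → Bool
inVi* P i x = ⌊ proj₁ (P x) ≟ i ⌋

inV*i : ∀ {n k} → Partition n k → Fin k → Fin n → Bool
inV*i P i x = ⌊ proj₂ (P x) ≟ i ⌋

outdegIn : ∀ {n} → Digraph n → (Fin n → Bool) → Fin n → ℕ
outdegIn E S x = count (λ y → E x y ∧ S y)

indegIn : ∀ {n} → Digraph n → (Fin n → Bool) → Fin n → ℕ
indegIn E S x = count (λ y → E y x ∧ S y)

SAdj : ∀ {n k} → Partition n k → Fin k → Fin k → Set
SAdj {n} P i j = ¬ (i ≡ j) × ∃[ x ] ((P x ≡ (i , j)) ⊎ (P x ≡ (j , i)))

data Reach {n k : ℕ} (P : Partition n k) (i : Fin k) : Fin k → Set where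
  here : Reach P i i
  step : ∀ {j l} → Reach P i j → SAdj P j l → Reach P i l

IsComponent : ∀ {n k} → Partition n k → Subset k → Set
IsComponent {n} {k} P I =
  Nonempty I
  × (∀ (i j : Fin k) → i ∈ I → j ∈ I → Reach P i j)
  × (∀ (i j : Fin k) → i ∈ I → SAdj P i j → j ∈ I)

memb : ∀ {k} → Subset k → Fin k → Bool
memb I i = lookup I i

unionSize : ∀ {n k} → Partition n k → Subset k → ℕ
unionSize P I = count (λ x → memb I (proj₁ (P x)) ∨ memb I (proj₂ (P x)))

-- Write D = d − γn and g = γn, and call x ∈ V_ij good if d⁺(x, V_{*i}) ≥ D and d⁻(x, V_{j*}) ≥ D;
-- by hypothesis each V_ij has at most g vertices that are not good. With γ₀ = α/(2k+1) we get
-- kg < d/2 ≤ |V_{i*}|, so by pigeonhole some V_ij has more than g vertices and hence a good one; in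
-- particular |V_{*i}| ≥ D for every i. As G is oriented, the out- and in-neighbourhoods of a good
-- x ∈ V_ij with i, j ∈ I are disjoint subsets of U = ⋃_{i∈I} (V_{i*} ∪ V_{*i}), so |U| ≥ 2D.
-- If I contains i ≠ j, either some x ∈ V_{*i} ∪ V_{*j} lies in a third row l ∈ I, and the disjoint
-- columns V_{*i}, V_{*j}, V_{*l} give |U| ≥ 3D; or V_{*i} ⊆ V_ii ∪ V_ji and V_{*j} ⊆ V_ij ∪ V_jj,
-- and then (unless D < 4g, when the claim is trivial) one of V_ij, V_ji, V_jj has at least D/4
-- vertices and lies outside both neighbourhoods of a good vertex of V_ij, V_ji or V_ii respectively,
-- giving |U| ≥ 2D + D/4. Finally 9D/4 ≥ 9(d − 5γn)/4.

module Submission where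

open import Defs
open import Data.Nat using (ℕ)
open import Data.Bool using (not; _∧_)
open import Data.Fin using (Fin)
open import Data.Fin.Subset using (Subset; ∣_∣)
open import Data.Product using (_×_; ∃-syntax)
open import Data.Integer using (+_)
open import Data.Rational using (ℚ; 0ℚ; _<_; _≤_; _*_; _-_; _/_; _≤ᵇ_)
open import Relation.Binary.PropositionalEquality using (_≡_)
open import Relation.Nullary using (¬_)

import Data.Nat as ℕ
import Data.Nat.Properties as ℕₚ
open import Data.Nat using (zero; suc; z≤n)
import Data.Nat.Coprimality as Coprime
import Data.Integer as ℤ
import Data.Integer.Properties as ℤₚ
open import Data.Bool using (Bool; true; false; _∨_; T; T?; if_then_else_)
open import Data.Bool.Properties using (T-∧; T-∨; T-≡)
open import Data.Fin using (zero; suc; _≟_)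
open import Data.Fin.Properties using (any?)
open import Data.Fin.Subset using (_∈_; _⊆_; ⁅_⁆)
open import Data.Fin.Subset.Properties using (_∈?_; x∈⁅x⁆; x∈⁅y⁆⇒x≡y; ∣⁅x⁆∣≡1; ⊆-antisym)
open import Data.Vec.Properties using ([]=⇒lookup)
open import Data.Product using (_,_; proj₁; proj₂; ∃)
open import Data.Sum using (_⊎_; inj₁; inj₂; [_,_])
import Data.Sum as Sum
open import Data.Empty using (⊥; ⊥-elim)
open import Data.Unit using (tt)
open import Data.Rational using (mkℚ; 1ℚ; _+_; -_; *≤*; *<*; positive; nonNegative)
import Data.Rational.Properties
open Data.Rational.Properties
  using (normalize-coprime; /-cong; *-inverseʳ; *-zeroˡ; +-identityʳ; +-inverseʳ;
         ≤-refl; ≤-reflexive; ≰⇒>; +-mono-≤-<; ≤-trans; <-≤-trans; ≤-<-trans; <-irrefl; <⇒≤; ≮⇒≥; _≤?_; _<?_;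
         +-mono-≤; +-monoʳ-≤; +-monoˡ-≤; +-monoʳ-<; +-mono-<-≤; *-monoˡ-≤-nonNeg; *-cancelˡ-<-nonNeg;
         positive⁻¹; nonNegative⁻¹; normalize-pos; pos*pos⇒pos; nonNeg*nonNeg⇒nonNeg; ≤ᵇ⇒≤)
open import Data.Rational.Solver using (module +-*-Solver)
open import Algebra.Properties.CommutativeSemigroup ℕₚ.+-commutativeSemigroup using (interchange)
open import Algebra.Properties.CommutativeMonoid.Sum ℕₚ.+-0-commutativeMonoid using (sum-syntax; ∑-distrib-+)
open import Function.Base using (_∘_)
open import Function.Bundles using (Equivalence)
open import Relation.Nullary using (Dec; yes; no; contradiction)
open import Relation.Nullary.Decidable using (⌊_⌋; toWitness; fromWitness; _×-dec_; _⊎-dec_; ¬?; decidable-stable; toSum)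
open import Relation.Binary.PropositionalEquality using (_≢_; refl; sym; trans; cong; cong₂; subst; subst₂; module ≡-Reasoning)

open Equivalence using (to; from)
open +-*-Solver

private
  variable
    n k : ℕ
    p q r s : Fin n → Bool

-- Counting Boolean predicates on Fin n

_⊆ᵇ_ : (p q : Fin n → Bool) → Set
p ⊆ᵇ q = ∀ x → T (p x) → T (q x)

Disjointᵇ : (p q : Fin n → Bool) → Set
Disjointᵇ p q = ∀ x → T (p x) → T (q x) → ⊥

𝟙 : Bool → ℕ
𝟙 b = if b then 1 else 0

𝟙-mono : ∀ {a b} → (T a → T b) → 𝟙 a ℕ.≤ 𝟙 b
𝟙-mono {false} _ = z≤n
𝟙-mono {true} {true} _ = ℕₚ.≤-refl
𝟙-mono {true} {false} a⇒b = ⊥-elim (a⇒b tt)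

𝟙-∨+𝟙-∧ : ∀ a b → 𝟙 a ℕ.+ 𝟙 b ≡ 𝟙 (a ∨ b) ℕ.+ 𝟙 (a ∧ b)
𝟙-∨+𝟙-∧ false false = refl
𝟙-∨+𝟙-∧ false true = refl
𝟙-∨+𝟙-∧ true false = refl
𝟙-∨+𝟙-∧ true true = refl

¬T⇒T-not : ∀ {b} → ¬ T b → T (not b)
¬T⇒T-not {false} _ = tt
¬T⇒T-not {true} ¬t = ¬t tt

count-mono : p ⊆ᵇ q → count p ℕ.≤ count q
count-mono {zero} _ = z≤n
count-mono {suc n} p⊆q = ℕₚ.+-mono-≤ (𝟙-mono (p⊆q zero)) (count-mono (p⊆q ∘ suc))

count-false : count {n} (λ _ → false) ≡ 0
count-false {zero} = refl
count-false {suc n} = count-false {n}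

count-≡0 : (∀ x → ¬ T (p x)) → count p ≡ 0
count-≡0 {n} {p} ¬p = ℕₚ.n≤0⇒n≡0 (subst (count p ℕ.≤_) (count-false {n}) (count-mono (λ x → ⊥-elim ∘ ¬p x)))

count-∨+count-∧ : ∀ (p q : Fin n → Bool) →
  count p ℕ.+ count q ≡ count (λ x → p x ∨ q x) ℕ.+ count (λ x → p x ∧ q x)
count-∨+count-∧ {zero} p q = refl
count-∨+count-∧ {suc n} p q =
  trans (interchange (𝟙 (p zero)) (count (p ∘ suc)) (𝟙 (q zero)) (count (q ∘ suc)))
    (trans (cong₂ ℕ._+_ (𝟙-∨+𝟙-∧ (p zero) (q zero)) (count-∨+count-∧ (p ∘ suc) (q ∘ suc)))
      (interchange (𝟙 (p zero ∨ q zero)) (𝟙 (p zero ∧ q zero))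
                   (count (λ x → p (suc x) ∨ q (suc x))) (count (λ x → p (suc x) ∧ q (suc x)))))

count-≤-+ : r ⊆ᵇ (λ x → p x ∨ q x) → count r ℕ.≤ count p ℕ.+ count q
count-≤-+ {r = r} {p} {q} r⊆p∨q = begin
  count r                                               ≤⟨ count-mono r⊆p∨q ⟩
  count (λ x → p x ∨ q x)                               ≤⟨ ℕₚ.m≤m+n _ _ ⟩
  count (λ x → p x ∨ q x) ℕ.+ count (λ x → p x ∧ q x)  ≡⟨ count-∨+count-∧ p q ⟨
  count p ℕ.+ count q                                   ∎
  where open ℕₚ.≤-Reasoning

count-+-≤ : Disjointᵇ p q → p ⊆ᵇ r → q ⊆ᵇ r → count p ℕ.+ count q ℕ.≤ count r
count-+-≤ {p = p} {q} {r} p⊥q p⊆r q⊆r = begin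
  count p ℕ.+ count q                                   ≡⟨ count-∨+count-∧ p q ⟩
  count (λ x → p x ∨ q x) ℕ.+ count (λ x → p x ∧ q x)  ≡⟨ cong (count (λ x → p x ∨ q x) ℕ.+_) (count-≡0 p∧q-empty) ⟩
  count (λ x → p x ∨ q x) ℕ.+ 0                         ≡⟨ ℕₚ.+-identityʳ _ ⟩
  count (λ x → p x ∨ q x)                               ≤⟨ count-mono (λ x → [ p⊆r x , q⊆r x ] ∘ to T-∨) ⟩
  count r                                               ∎
  where
  open ℕₚ.≤-Reasoning
  p∧q-empty : ∀ x → ¬ T (p x ∧ q x)
  p∧q-empty x pq = let (px , qx) = to T-∧ pq in p⊥q x px qx

witness-outside : count (λ x → p x ∧ not (q x)) ℕ.< count p → ∃ λ x → T (p x) × T (q x)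
witness-outside {p = p} {q} few with any? (λ x → T? (p x) ×-dec T? (q x))
... | yes w = w
... | no ∄ = contradiction (count-mono p⊆p∧¬q) (ℕₚ.<⇒≱ few)
  where
  p⊆p∧¬q : p ⊆ᵇ (λ x → p x ∧ not (q x))
  p⊆p∧¬q x px = from T-∧ (px , ¬T⇒T-not (λ qx → ∄ (x , px , qx)))

≤-∑ : ∀ (h : Fin k → ℕ) l → h l ℕ.≤ ∑[ i < k ] h i
≤-∑ h zero = ℕₚ.m≤m+n _ _
≤-∑ h (suc l) = ℕₚ.≤-trans (≤-∑ (h ∘ suc) l) (ℕₚ.m≤n+m _ _)

count-≤-∑-fibres : ∀ (p : Fin n → Bool) (f : Fin n → Fin k) →
  count p ℕ.≤ ∑[ l < k ] count (λ x → p x ∧ ⌊ f x ≟ l ⌋)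
count-≤-∑-fibres {zero} p f = z≤n
count-≤-∑-fibres {suc n} {k} p f = begin
  𝟙 (p zero) ℕ.+ count (p ∘ suc)
    ≤⟨ ℕₚ.+-mono-≤ head-≤ (count-≤-∑-fibres (p ∘ suc) (f ∘ suc)) ⟩
  ∑[ l < k ] head l ℕ.+ ∑[ l < k ] tail l
    ≡⟨ ∑-distrib-+ head tail ⟨
  ∑[ l < k ] (head l ℕ.+ tail l) ∎
  where
  open ℕₚ.≤-Reasoning
  head tail : Fin k → ℕ
  head l = 𝟙 (p zero ∧ ⌊ f zero ≟ l ⌋)
  tail l = count (λ x → p (suc x) ∧ ⌊ f (suc x) ≟ l ⌋)
  head-≤ : 𝟙 (p zero) ℕ.≤ ∑[ l < k ] head l
  head-≤ = ℕₚ.≤-trans (𝟙-mono (λ h → from T-∧ (h , fromWitness refl))) (≤-∑ head (f zero))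

-- The embedding ℕ → ℚ

ℕ→ℚ-mkℚ : ∀ m → ℕ→ℚ m ≡ mkℚ (+ m) 0 (Coprime.sym (Coprime.1-coprimeTo m))
ℕ→ℚ-mkℚ m = normalize-coprime (Coprime.sym (Coprime.1-coprimeTo m))

ℕ→ℚ-+ : ∀ a b → ℕ→ℚ (a ℕ.+ b) ≡ ℕ→ℚ a + ℕ→ℚ b
ℕ→ℚ-+ a b rewrite ℕ→ℚ-mkℚ a | ℕ→ℚ-mkℚ b =
  sym (/-cong (cong₂ ℤ._+_ (ℤₚ.*-identityʳ (+ a)) (ℤₚ.*-identityʳ (+ b))) refl)

ℕ→ℚ-mono-≤ : ∀ {a b} → a ℕ.≤ b → ℕ→ℚ a ≤ ℕ→ℚ b
ℕ→ℚ-mono-≤ {a} {b} a≤b rewrite ℕ→ℚ-mkℚ a | ℕ→ℚ-mkℚ b =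
  *≤* (subst₂ ℤ._≤_ (sym (ℤₚ.*-identityʳ (+ a))) (sym (ℤₚ.*-identityʳ (+ b))) (ℤ.+≤+ a≤b))

ℕ→ℚ-mono-< : ∀ {a b} → a ℕ.< b → ℕ→ℚ a < ℕ→ℚ b
ℕ→ℚ-mono-< {a} {b} a<b rewrite ℕ→ℚ-mkℚ a | ℕ→ℚ-mkℚ b =
  *<* (subst₂ ℤ._<_ (sym (ℤₚ.*-identityʳ (+ a))) (sym (ℤₚ.*-identityʳ (+ b))) (ℤ.+<+ a<b))

ℕ→ℚ-cancel-< : ∀ {a b} → ℕ→ℚ a < ℕ→ℚ b → a ℕ.< b
ℕ→ℚ-cancel-< {a} {b} lt with a ℕ.<? b
... | yes a<b = a<b
... | no a≮b = contradiction (≤-<-trans (ℕ→ℚ-mono-≤ (ℕₚ.≮⇒≥ a≮b)) lt) (<-irrefl refl)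

0≤ℕ→ℚ : ∀ a → 0ℚ ≤ ℕ→ℚ a
0≤ℕ→ℚ a = ℕ→ℚ-mono-≤ {0} {a} z≤n

ℕ→ℚ-*-inverse : ∀ m → ℕ→ℚ (suc m) * (+ 1 / suc m) ≡ 1ℚ
ℕ→ℚ-*-inverse m rewrite ℕ→ℚ-mkℚ (suc m) | normalize-coprime {1} {m} (Coprime.1-coprimeTo (suc m)) =
  *-inverseʳ (mkℚ (+ suc m) 0 (Coprime.sym (Coprime.1-coprimeTo (suc m))))

ℕ→ℚ-∑-≤ : ∀ (h : Fin k → ℕ) {c} → (∀ l → ℕ→ℚ (h l) ≤ c) → ℕ→ℚ (∑[ l < k ] h l) ≤ ℕ→ℚ k * c
ℕ→ℚ-∑-≤ {zero} h {c} _ = ≤-reflexive (sym (*-zeroˡ c))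
ℕ→ℚ-∑-≤ {suc k} h {c} h≤c = begin
  ℕ→ℚ (h zero ℕ.+ ∑[ l < k ] h (suc l))       ≡⟨ ℕ→ℚ-+ (h zero) _ ⟩
  ℕ→ℚ (h zero) + ℕ→ℚ (∑[ l < k ] h (suc l))   ≤⟨ +-mono-≤ (h≤c zero) (ℕ→ℚ-∑-≤ (h ∘ suc) (h≤c ∘ suc)) ⟩
  c + ℕ→ℚ k * c                                ≡⟨ solve 2 (λ c K → c :+ K :* c := (con 1ℚ :+ K) :* c) refl c (ℕ→ℚ k) ⟩
  (1ℚ + ℕ→ℚ k) * c                             ≡⟨ cong (_* c) (ℕ→ℚ-+ 1 k) ⟨
  ℕ→ℚ (suc k) * c                              ∎
  where open Data.Rational.Properties.≤-Reasoning

#_ : (Fin n → Bool) → ℚ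
# p = ℕ→ℚ (count p)

#-mono : ∀ (p q : Fin n → Bool) → p ⊆ᵇ q → # p ≤ # q
#-mono p q p⊆q = ℕ→ℚ-mono-≤ (count-mono p⊆q)

#-≤-+ : r ⊆ᵇ (λ x → p x ∨ q x) → # r ≤ # p + # q
#-≤-+ {p = p} {q} r⊆p∨q = subst (_ ≤_) (ℕ→ℚ-+ (count p) (count q)) (ℕ→ℚ-mono-≤ (count-≤-+ r⊆p∨q))

#-+-+-≤ : Disjointᵇ p q → Disjointᵇ p r → Disjointᵇ q r → p ⊆ᵇ s → q ⊆ᵇ s → r ⊆ᵇ s → # p + # q + # r ≤ # s
#-+-+-≤ {p = p} {q} {r} {s} p⊥q p⊥r q⊥r p⊆s q⊆s r⊆s =
  subst (_≤ # s) (trans (ℕ→ℚ-+ (count p ℕ.+ count q) (count r)) (cong (_+ # r) (ℕ→ℚ-+ (count p) (count q))))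
    (ℕ→ℚ-mono-≤ (ℕₚ.≤-trans (ℕₚ.+-mono-≤ p+q≤p∨q (ℕₚ.≤-refl {count r})) p∨q+r≤s))
  where
  p+q≤p∨q : count p ℕ.+ count q ℕ.≤ count (λ x → p x ∨ q x)
  p+q≤p∨q = count-+-≤ p⊥q (λ _ → from T-∨ ∘ inj₁) (λ _ → from T-∨ ∘ inj₂)
  p∨q+r≤s : count (λ x → p x ∨ q x) ℕ.+ count r ℕ.≤ count s
  p∨q+r≤s = count-+-≤ (λ x p∨q rx → [ (λ px → p⊥r x px rx) , (λ qx → q⊥r x qx rx) ] (to T-∨ p∨q))
                      (λ x → [ p⊆s x , q⊆s x ] ∘ to T-∨) r⊆s

fibre-pigeonhole : ∀ (p : Fin n → Bool) (f : Fin n → Fin k) {c} → ℕ→ℚ k * c < # p →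
  ∃ λ l → c < # (λ x → p x ∧ ⌊ f x ≟ l ⌋)
fibre-pigeonhole {k = k} p f {c} kc<p with any? (λ l → c <? # (λ x → p x ∧ ⌊ f x ≟ l ⌋))
... | yes large = large
... | no ∄ = contradiction (<-≤-trans kc<p p≤kc) (<-irrefl refl)
  where
  p≤kc : # p ≤ ℕ→ℚ k * c
  p≤kc = ≤-trans (ℕ→ℚ-mono-≤ (count-≤-∑-fibres p f)) (ℕ→ℚ-∑-≤ _ (λ l → ≮⇒≥ (∄ ∘ (l ,_))))

-- Linear arithmetic in ℚ

≤-by-gap : ∀ {a b} c → 0ℚ ≤ c → a + c ≡ b → a ≤ b
≤-by-gap {a} c 0≤c refl = subst (_≤ a + c) (+-identityʳ a) (+-monoʳ-≤ a 0≤c)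

<-by-gap : ∀ {a b} c → 0ℚ < c → a + c ≡ b → a < b
<-by-gap {a} c 0<c refl = subst (_< a + c) (+-identityʳ a) (+-monoʳ-< a 0<c)

0≤-gap : ∀ {a b} → a ≤ b → 0ℚ ≤ b - a
0≤-gap {a} {b} a≤b = subst (_≤ b - a) (+-inverseʳ a) (+-monoˡ-≤ (- a) a≤b)

0≤* : ∀ {a b} → 0ℚ ≤ a → 0ℚ ≤ b → 0ℚ ≤ a * b
0≤* {a} {b} 0≤a 0≤b =
  nonNegative⁻¹ (a * b) {{nonNeg*nonNeg⇒nonNeg a {{nonNegative 0≤a}} b {{nonNegative 0≤b}}}}

0<* : ∀ {a b} → 0ℚ < a → 0ℚ < b → 0ℚ < a * b
0<* {a} {b} 0<a 0<b = positive⁻¹ (a * b) {{pos*pos⇒pos a {{positive 0<a}} b {{positive 0<b}}}}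

twice-≤ : ∀ {D t} → D + D ≤ t → (+ 2 / 1) * D ≤ t
twice-≤ {D} = subst (_≤ _) (solve 1 (λ D → D :+ D := con (+ 2 / 1) :* D) refl D)

≤-four-times : ∀ {z} → 0ℚ ≤ z → z ≤ (+ 4 / 1) * z
≤-four-times {z} 0≤z = ≤-by-gap ((+ 3 / 1) * z) (*-monoˡ-≤-nonNeg (+ 3 / 1) 0≤z)
  (solve 1 (λ z → z :+ con (+ 3 / 1) :* z := con (+ 4 / 1) :* z) refl z)

nine-quarters-≤ : ∀ {D z t} → D + D + z ≤ t → D ≤ (+ 4 / 1) * z → (+ 9 / 4) * D ≤ t
nine-quarters-≤ {D} {z} {t} D+D+z≤t D≤4z = begin
  (+ 9 / 4) * D                         ≡⟨ solve 1 (λ D → con (+ 9 / 4) :* D := D :+ D :+ con (+ 1 / 4) :* D) refl D ⟩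
  D + D + (+ 1 / 4) * D                 ≤⟨ +-monoʳ-≤ (D + D) (*-monoˡ-≤-nonNeg (+ 1 / 4) D≤4z) ⟩
  D + D + (+ 1 / 4) * ((+ 4 / 1) * z)   ≡⟨ cong (_+_ (D + D)) (solve 1 (λ z → con (+ 1 / 4) :* (con (+ 4 / 1) :* z) := z) refl z) ⟩
  D + D + z                             ≤⟨ D+D+z≤t ⟩
  t                                     ∎
  where open Data.Rational.Properties.≤-Reasoning

<⊎≥ : ∀ a b → a < b ⊎ b ≤ a
<⊎≥ a b = Sum.map₂ ≮⇒≥ (toSum (a <? b))

<-of-quarters : ∀ {g D b} → (+ 4 / 1) * g ≤ D → D < (+ 4 / 1) * b → g < b
<-of-quarters 4g≤D D<4b = *-cancelˡ-<-nonNeg (+ 4 / 1) (≤-<-trans 4g≤D D<4b)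

<-of-quarter-gaps : ∀ {g D a c} → 0ℚ < g → (+ 4 / 1) * g ≤ D → (+ 4 / 1) * c ≤ D → D ≤ a + c → g < a
<-of-quarter-gaps {g} {D} {a} {c} 0<g 4g≤D 4c≤D D≤a+c = <-by-gap gap 0<gap
  (solve 4 (λ g D a c → g :+ (con (+ 2 / 1) :* g :+ con (+ 3 / 4) :* (D :- con (+ 4 / 1) :* g)
                               :+ con (+ 1 / 4) :* (D :- con (+ 4 / 1) :* c) :+ ((a :+ c) :- D)) := a)
         refl g D a c)
  where
  gap : ℚ
  gap = (+ 2 / 1) * g + (+ 3 / 4) * (D - (+ 4 / 1) * g) + (+ 1 / 4) * (D - (+ 4 / 1) * c) + ((a + c) - D)
  0<gap : 0ℚ < gap
  0<gap = +-mono-<-≤ (+-mono-<-≤ (+-mono-<-≤ (0<* (positive⁻¹ (+ 2 / 1)) 0<g)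
                                              (*-monoˡ-≤-nonNeg (+ 3 / 4) (0≤-gap 4g≤D)))
                                  (*-monoˡ-≤-nonNeg (+ 1 / 4) (0≤-gap 4c≤D)))
                     (0≤-gap D≤a+c)

≤-of-quarter-gap : ∀ {b D e} → 0ℚ ≤ b → (+ 4 / 1) * b ≤ D → D ≤ b + e → D ≤ (+ 4 / 1) * e
≤-of-quarter-gap {b} {D} {e} 0≤b 4b≤D D≤b+e = ≤-by-gap gap 0≤gap
  (solve 3 (λ b D e → D :+ (con (+ 4 / 1) :* ((b :+ e) :- D) :+ con (+ 3 / 1) :* (D :- con (+ 4 / 1) :* b)
                             :+ con (+ 8 / 1) :* b) := con (+ 4 / 1) :* e)
         refl b D e)
  where
  gap : ℚ
  gap = (+ 4 / 1) * ((b + e) - D) + (+ 3 / 1) * (D - (+ 4 / 1) * b) + (+ 8 / 1) * b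
  0≤gap : 0ℚ ≤ gap
  0≤gap = +-mono-≤ (+-mono-≤ (*-monoˡ-≤-nonNeg (+ 4 / 1) (0≤-gap D≤b+e))
                             (*-monoˡ-≤-nonNeg (+ 3 / 1) (0≤-gap 4b≤D)))
                   (*-monoˡ-≤-nonNeg (+ 8 / 1) 0≤b)

nine-quarters-of-d-5g : ∀ {d g t} → 0ℚ ≤ g → 0ℚ ≤ t →
  ((+ 4 / 1) * g ≤ d - g → (+ 9 / 4) * (d - g) ≤ t) → (+ 9 / 4) * (d - (+ 5 / 1) * g) ≤ t
nine-quarters-of-d-5g {d} {g} {t} 0≤g 0≤t large with (+ 4 / 1) * g ≤? d - g
... | yes 4g≤d-g = ≤-trans (≤-by-gap ((+ 9 / 1) * g) (*-monoˡ-≤-nonNeg (+ 9 / 1) 0≤g)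
        (solve 2 (λ d g → con (+ 9 / 4) :* (d :- con (+ 5 / 1) :* g) :+ con (+ 9 / 1) :* g
                            := con (+ 9 / 4) :* (d :- g)) refl d g))
      (large 4g≤d-g)
... | no 4g≰d-g = ≤-by-gap ((+ 9 / 4) * ((+ 4 / 1) * g - (d - g)) + t)
        (+-mono-≤ (*-monoˡ-≤-nonNeg (+ 9 / 4) (0≤-gap (<⇒≤ (≰⇒> 4g≰d-g)))) 0≤t)
        (solve 3 (λ d g t → con (+ 9 / 4) :* (d :- con (+ 5 / 1) :* g)
                              :+ (con (+ 9 / 4) :* (con (+ 4 / 1) :* g :- (d :- g)) :+ t) := t) refl d g t)

K·γN<d/2 : ∀ {α N c K γ d} → 0ℚ < α → 0ℚ < N → 0ℚ < c → 0ℚ ≤ K → (1ℚ + (K + K)) * c ≡ 1ℚ →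
  γ ≤ α * c → α * N ≤ d → K * (γ * N) < d * (+ 1 / 2)
K·γN<d/2 {α} {N} {c} {K} {γ} {d} 0<α 0<N 0<c 0≤K [1+2K]c≡1 γ≤αc αN≤d = <-by-gap gap 0<gap (begin
  K * (γ * N) + gap
    ≡⟨ solve 6 (λ α N c K γ d → K :* (γ :* N) :+ (con (+ 1 / 2) :* (d :- α :* N) :+ K :* (N :* (α :* c :- γ))
                                  :+ con (+ 1 / 2) :* (α :* N :* c))
                 := con (+ 1 / 2) :* (d :- α :* N) :+ con (+ 1 / 2) :* (α :* N) :* ((con 1ℚ :+ (K :+ K)) :* c))
               refl α N c K γ d ⟩
  (+ 1 / 2) * (d - α * N) + (+ 1 / 2) * (α * N) * ((1ℚ + (K + K)) * c)
    ≡⟨ cong (λ w → (+ 1 / 2) * (d - α * N) + (+ 1 / 2) * (α * N) * w) [1+2K]c≡1 ⟩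
  (+ 1 / 2) * (d - α * N) + (+ 1 / 2) * (α * N) * 1ℚ
    ≡⟨ solve 3 (λ α N d → con (+ 1 / 2) :* (d :- α :* N) :+ con (+ 1 / 2) :* (α :* N) :* con 1ℚ
                          := d :* con (+ 1 / 2)) refl α N d ⟩
  d * (+ 1 / 2) ∎)
  where
  open ≡-Reasoning
  gap : ℚ
  gap = (+ 1 / 2) * (d - α * N) + K * (N * (α * c - γ)) + (+ 1 / 2) * (α * N * c)
  0<gap : 0ℚ < gap
  0<gap = +-mono-≤-< (+-mono-≤ (*-monoˡ-≤-nonNeg (+ 1 / 2) (0≤-gap αN≤d))
                               (0≤* 0≤K (0≤* (<⇒≤ 0<N) (0≤-gap γ≤αc))))
                     (0<* (positive⁻¹ (+ 1 / 2)) (0<* (0<* 0<α 0<N) 0<c))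

-- Oriented graphs, partitions and components

out-in-disjoint : ∀ {E : Digraph n} → Oriented E → ∀ x (S S′ : Fin n → Bool) →
  Disjointᵇ (λ y → E x y ∧ S y) (λ y → E y x ∧ S′ y)
out-in-disjoint (_ , asym) x S S′ y x→y y→x =
  subst T (asym x y (to T-≡ (proj₁ (to T-∧ x→y)))) (proj₁ (to T-∧ y→x))

∈⇒T-memb : ∀ {I : Subset k} {i} → i ∈ I → T (memb I i)
∈⇒T-memb i∈I = from T-≡ ([]=⇒lookup i∈I)

∃-other-element : ∀ {I : Subset k} {i} → i ∈ I → ∣ I ∣ ≢ 1 → ∃ λ j → j ∈ I × j ≢ i
∃-other-element {I = I} {i} i∈I ∣I∣≢1 with any? (λ j → (j ∈? I) ×-dec ¬? (j ≟ i))
... | yes other = other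
... | no ∄ = contradiction (trans (cong ∣_∣ (⊆-antisym I⊆⁅i⁆ ⁅i⁆⊆I)) (∣⁅x⁆∣≡1 i)) ∣I∣≢1
  where
  I⊆⁅i⁆ : I ⊆ ⁅ i ⁆
  I⊆⁅i⁆ {j} j∈I with j ≟ i
  ... | yes refl = x∈⁅x⁆ i
  ... | no j≢i = contradiction (j , j∈I , j≢i) ∄
  ⁅i⁆⊆I : ⁅ i ⁆ ⊆ I
  ⁅i⁆⊆I j∈⁅i⁆ = subst (_∈ I) (sym (x∈⁅y⁆⇒x≡y i j∈⁅i⁆)) i∈I

module _ {P : Partition n k} {I : Subset k} (closed : ∀ i j → i ∈ I → SAdj P i j → j ∈ I) where

  row∈⇒column∈ : ∀ x → proj₁ (P x) ∈ I → proj₂ (P x) ∈ I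
  row∈⇒column∈ x i∈I with proj₁ (P x) ≟ proj₂ (P x)
  ... | yes i≡j = subst (_∈ I) i≡j i∈I
  ... | no i≢j = closed _ _ i∈I (i≢j , x , inj₁ refl)

  column∈⇒row∈ : ∀ x → proj₂ (P x) ∈ I → proj₁ (P x) ∈ I
  column∈⇒row∈ x j∈I with proj₂ (P x) ≟ proj₁ (P x)
  ... | yes j≡i = subst (_∈ I) j≡i j∈I
  ... | no j≢i = closed _ _ j∈I (j≢i , x , inj₂ refl)

Good : Digraph n → Partition n k → ℚ → Fin k → Fin k → Fin n → Bool
Good E P D i j x = (D ≤ᵇ ℕ→ℚ (outdegIn E (inV*i P i) x)) ∧ (D ≤ᵇ ℕ→ℚ (indegIn E (inVi* P j) x))

InUnion : Partition n k → Subset k → Fin n → Bool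
InUnion P I x = memb I (proj₁ (P x)) ∨ memb I (proj₂ (P x))

-- A fixed component I

module Component {n k : ℕ} (E : Digraph n) (oriented : Oriented E) (P : Partition n k) (I : Subset k)
  (closed : ∀ i j → i ∈ I → SAdj P i j → j ∈ I) (D g : ℚ) (0<g : 0ℚ < g)
  (few-bad : ∀ i j → # (λ x → inVij P i j x ∧ not (Good E P D i j x)) ≤ g)
  (rows-large : ∀ i → ℕ→ℚ k * g < # inVi* P i)
  where

  U : Fin n → Bool
  U = InUnion P I

  module _ {i j : Fin k} {x : Fin n} where

    good⇒D≤outdeg : T (Good E P D i j x) → D ≤ ℕ→ℚ (outdegIn E (inV*i P i) x)
    good⇒D≤outdeg = ≤ᵇ⇒≤ ∘ proj₁ ∘ to T-∧

    good⇒D≤indeg : T (Good E P D i j x) → D ≤ ℕ→ℚ (indegIn E (inVi* P j) x)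
    good⇒D≤indeg = ≤ᵇ⇒≤ ∘ proj₂ ∘ to T-∧

    inVij⇒row : T (inVij P i j x) → proj₁ (P x) ≡ i
    inVij⇒row = toWitness ∘ proj₁ ∘ to (T-∧ {⌊ proj₁ (P x) ≟ i ⌋} {⌊ proj₂ (P x) ≟ j ⌋})

    inVij⇒column : T (inVij P i j x) → proj₂ (P x) ≡ j
    inVij⇒column = toWitness ∘ proj₂ ∘ to (T-∧ {⌊ proj₁ (P x) ≟ i ⌋} {⌊ proj₂ (P x) ≟ j ⌋})

    inVij-intro : proj₁ (P x) ≡ i → T (inV*i P j x) → T (inVij P i j x)
    inVij-intro row≡i in-column = from (T-∧ {⌊ proj₁ (P x) ≟ i ⌋} {⌊ proj₂ (P x) ≟ j ⌋}) (fromWitness row≡i , in-column)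

  good-vertex : ∀ i j → g < # inVij P i j → ∃ λ x → T (inVij P i j x) × T (Good E P D i j x)
  good-vertex i j large = witness-outside (ℕ→ℚ-cancel-< (≤-<-trans (few-bad i j) large))

  row-has-large-part : ∀ i → ∃ λ j → g < # inVij P i j
  row-has-large-part i = fibre-pigeonhole (inVi* P i) (proj₂ ∘ P) (rows-large i)

  D≤column : ∀ i → D ≤ # inV*i P i
  D≤column i =
    let (j , large) = row-has-large-part i
        (x , _ , good) = good-vertex i j large
    in ≤-trans (good⇒D≤outdeg good) (#-mono (λ y → E x y ∧ inV*i P i y) (inV*i P i) (λ _ → proj₂ ∘ to T-∧))

  row⊆U : ∀ {i} → i ∈ I → inVi* P i ⊆ᵇ U
  row⊆U i∈I x in-row = from T-∨ (inj₁ (subst (T ∘ memb I) (sym (toWitness in-row)) (∈⇒T-memb i∈I)))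

  column⊆U : ∀ {i} → i ∈ I → inV*i P i ⊆ᵇ U
  column⊆U i∈I x in-col = from T-∨ (inj₂ (subst (T ∘ memb I) (sym (toWitness in-col)) (∈⇒T-memb i∈I)))

  two-neighbourhoods : ∀ {p q x} {Z : Fin n → Bool} → p ∈ I → q ∈ I → T (Good E P D p q x) →
    Z ⊆ᵇ U → Disjointᵇ Z (inV*i P p) → Disjointᵇ Z (inVi* P q) → D + D + # Z ≤ # U
  two-neighbourhoods {p} {q} {x} {Z} p∈I q∈I good Z⊆U Z⊥column Z⊥row = begin
    D + D + # Z           ≤⟨ +-mono-≤ (+-mono-≤ (good⇒D≤outdeg good) (good⇒D≤indeg good)) ≤-refl ⟩
    # out + # into + # Z  ≤⟨ #-+-+-≤ (out-in-disjoint oriented x (inV*i P p) (inVi* P q))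
                                     (λ y o z → Z⊥column y z (proj₂ (to T-∧ o)))
                                     (λ y i z → Z⊥row y z (proj₂ (to T-∧ i)))
                                     (λ y → column⊆U p∈I y ∘ proj₂ ∘ to T-∧)
                                     (λ y → row⊆U q∈I y ∘ proj₂ ∘ to T-∧) Z⊆U ⟩
    # U                   ∎
    where
    open Data.Rational.Properties.≤-Reasoning
    out into : Fin n → Bool
    out y = E x y ∧ inV*i P p y
    into y = E y x ∧ inVi* P q y

  union-≥-2D : ∀ {i} → i ∈ I → D + D ≤ # U
  union-≥-2D {i} i∈I =
    let (j , large) = row-has-large-part i
        (x , x∈Vij , good) = good-vertex i j large
        j∈I = subst (_∈ I) (inVij⇒column x∈Vij)
                (row∈⇒column∈ closed x (subst (_∈ I) (sym (inVij⇒row x∈Vij)) i∈I))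
    in subst (_≤ # U) (trans (cong (λ m → D + D + ℕ→ℚ m) (count-false {n})) (+-identityʳ (D + D)))
         (two-neighbourhoods i∈I j∈I good (λ _ ()) (λ _ ()) (λ _ ()))

  nine-quarters-from-parts : ∀ {p q r s} → p ∈ I → q ∈ I → r ∈ I → s ≢ p → r ≢ q →
    g < # inVij P p q → D ≤ (+ 4 / 1) * # inVij P r s → (+ 9 / 4) * D ≤ # U
  nine-quarters-from-parts {p} {q} {r} {s} p∈I q∈I r∈I s≢p r≢q large D≤4Vrs =
    nine-quarters-≤ (two-neighbourhoods p∈I q∈I good Vrs⊆U Vrs⊥column Vrs⊥row) D≤4Vrs
    where
    good : T (Good E P D p q (proj₁ (good-vertex p q large)))
    good = proj₂ (proj₂ (good-vertex p q large))
    Vrs⊆U : inVij P r s ⊆ᵇ U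
    Vrs⊆U y y∈Vrs = row⊆U r∈I y (fromWitness (inVij⇒row y∈Vrs))
    Vrs⊥column : Disjointᵇ (inVij P r s) (inV*i P p)
    Vrs⊥column y y∈Vrs y∈column = s≢p (trans (sym (inVij⇒column y∈Vrs)) (toWitness y∈column))
    Vrs⊥row : Disjointᵇ (inVij P r s) (inVi* P q)
    Vrs⊥row y y∈Vrs y∈row = r≢q (trans (sym (inVij⇒row y∈Vrs)) (toWitness y∈row))

  nine-quarters-from-columns : ∀ {i j l} → i ∈ I → j ∈ I → l ∈ I → i ≢ j → i ≢ l → j ≢ l →
    (+ 9 / 4) * D ≤ # U
  nine-quarters-from-columns {i} {j} {l} i∈I j∈I l∈I i≢j i≢l j≢l = nine-quarters-≤
    (≤-trans (+-mono-≤ (+-mono-≤ (D≤column i) (D≤column j)) ≤-refl)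
             (#-+-+-≤ (columns-disjoint i≢j) (columns-disjoint i≢l) (columns-disjoint j≢l)
                      (column⊆U i∈I) (column⊆U j∈I) (column⊆U l∈I)))
    (≤-trans (D≤column l) (≤-four-times (0≤ℕ→ℚ (count (inV*i P l)))))
    where
    columns-disjoint : ∀ {a b} → a ≢ b → Disjointᵇ (inV*i P a) (inV*i P b)
    columns-disjoint a≢b y y∈a y∈b = a≢b (trans (sym (toWitness y∈a)) (toWitness y∈b))

  nine-quarters-if-columns-covered : ∀ {i j} → i ∈ I → j ∈ I → i ≢ j → (+ 4 / 1) * g ≤ D →
    inV*i P i ⊆ᵇ (λ x → inVij P i i x ∨ inVij P j i x) →
    inV*i P j ⊆ᵇ (λ x → inVij P i j x ∨ inVij P j j x) → (+ 9 / 4) * D ≤ # U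
  nine-quarters-if-columns-covered {i} {j} i∈I j∈I i≢j 4g≤D covered-i covered-j =
    [ large-Vij , (λ 4Vij≤D → [ large-Vji , both-small 4Vij≤D ] (<⊎≥ D ((+ 4 / 1) * Vji))) ] (<⊎≥ D ((+ 4 / 1) * Vij))
    where
    Vij Vji : ℚ
    Vij = # inVij P i j
    Vji = # inVij P j i
    large-Vij : D < (+ 4 / 1) * Vij → (+ 9 / 4) * D ≤ # U
    large-Vij D<4Vij =
      nine-quarters-from-parts i∈I j∈I i∈I (i≢j ∘ sym) i≢j (<-of-quarters 4g≤D D<4Vij) (<⇒≤ D<4Vij)
    large-Vji : D < (+ 4 / 1) * Vji → (+ 9 / 4) * D ≤ # U
    large-Vji D<4Vji =
      nine-quarters-from-parts j∈I i∈I j∈I i≢j (i≢j ∘ sym) (<-of-quarters 4g≤D D<4Vji) (<⇒≤ D<4Vji)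
    both-small : (+ 4 / 1) * Vij ≤ D → (+ 4 / 1) * Vji ≤ D → (+ 9 / 4) * D ≤ # U
    both-small 4Vij≤D 4Vji≤D =
      nine-quarters-from-parts i∈I i∈I j∈I (i≢j ∘ sym) (i≢j ∘ sym)
        (<-of-quarter-gaps 0<g 4g≤D 4Vji≤D (≤-trans (D≤column i) (#-≤-+ covered-i)))
        (≤-of-quarter-gap (0≤ℕ→ℚ (count (inVij P i j))) 4Vij≤D (≤-trans (D≤column j) (#-≤-+ covered-j)))

  union-≥-9D/4 : ∀ {i j} → i ∈ I → j ∈ I → i ≢ j → (+ 4 / 1) * g ≤ D → (+ 9 / 4) * D ≤ # U
  union-≥-9D/4 {i} {j} i∈I j∈I i≢j 4g≤D = [ from-stray , from-no-stray ] (toSum (any? stray?))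
    where
    InRowIJ InColumnIJ : Fin n → Set
    InRowIJ x = proj₁ (P x) ≡ i ⊎ proj₁ (P x) ≡ j
    InColumnIJ x = proj₂ (P x) ≡ i ⊎ proj₂ (P x) ≡ j

    stray? : ∀ x → Dec (InColumnIJ x × ¬ InRowIJ x)
    stray? x = (proj₂ (P x) ≟ i ⊎-dec proj₂ (P x) ≟ j) ×-dec ¬? (proj₁ (P x) ≟ i ⊎-dec proj₁ (P x) ≟ j)

    from-stray : ∃ (λ x → InColumnIJ x × ¬ InRowIJ x) → (+ 9 / 4) * D ≤ # U
    from-stray (x , in-column , ¬in-row) =
      nine-quarters-from-columns i∈I j∈I l∈I i≢j (¬in-row ∘ inj₁ ∘ sym) (¬in-row ∘ inj₂ ∘ sym)
      where
      l∈I : proj₁ (P x) ∈ I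
      l∈I = column∈⇒row∈ closed x ([ (λ e → subst (_∈ I) (sym e) i∈I) , (λ e → subst (_∈ I) (sym e) j∈I) ] in-column)

    from-no-stray : ¬ ∃ (λ x → InColumnIJ x × ¬ InRowIJ x) → (+ 9 / 4) * D ≤ # U
    from-no-stray ∄ =
      nine-quarters-if-columns-covered i∈I j∈I i≢j 4g≤D (covered (inj₁ ∘ toWitness)) (covered (inj₂ ∘ toWitness))
      where
      covered : ∀ {c} → (∀ {y} → T (inV*i P c y) → InColumnIJ y) →
        inV*i P c ⊆ᵇ (λ y → inVij P i c y ∨ inVij P j c y)
      covered {c} in-column y y∈column =
        from (T-∨ {inVij P i c y} {inVij P j c y})
          (Sum.map (λ e → inVij-intro e y∈column) (λ e → inVij-intro e y∈column)
                  (decidable-stable (proj₁ (P y) ≟ i ⊎-dec proj₁ (P y) ≟ j)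
                                    (λ ¬in-row → ∄ (y , in-column y∈column , ¬in-row))))

-- Only the closure of I under adjacency in S(P) is used: neither the connectivity of I nor the
-- bound Δ⁰(G) ≤ d enters the argument.
proposition6p5 : ∀ (α : ℚ) → 0ℚ < α → ∀ (k : ℕ) →
    ∃[ γ₀ ] (0ℚ < γ₀ ×
      (∀ (γ : ℚ) → 0ℚ < γ → γ ≤ γ₀ →
        ∃[ n₀ ] (∀ (n : ℕ) → n₀ Data.Nat.≤ n →
          ∀ (E : Digraph n) (d : ℚ) (P : Partition n k) (I : Subset k) →
          Oriented E →
          MaxSemiDegreeAtMost E d →
          α * ℕ→ℚ n ≤ d →
          (∀ (i : Fin k) → d * (+ 1 / 2) ≤ ℕ→ℚ (count (inVi* P i))) →
          (∀ (i j : Fin k) →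
            ℕ→ℚ (count (λ x → inVij P i j x ∧
                   not (((d - γ * ℕ→ℚ n) ≤ᵇ ℕ→ℚ (outdegIn E (inV*i P i) x))
                        ∧ ((d - γ * ℕ→ℚ n) ≤ᵇ ℕ→ℚ (indegIn E (inVi* P j) x)))))
              ≤ γ * ℕ→ℚ n) →
          IsComponent P I →
          ((∣ I ∣ ≡ 1 → (+ 2 / 1) * (d - γ * ℕ→ℚ n) ≤ ℕ→ℚ (unionSize P I))
           × (¬ (∣ I ∣ ≡ 1) →
              (+ 9 / 4) * (d - (+ 5 / 1) * (γ * ℕ→ℚ n)) ≤ ℕ→ℚ (unionSize P I))))))
proposition6p5 α 0<α k = α * c , 0<* 0<α 0<c , λ γ 0<γ γ≤αc → 1 ,
  λ n 1≤n E d P I oriented _ αn≤d rows-half few-bad ((i , i∈I) , _ , closed) →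
    let g = γ * ℕ→ℚ n
        0<n = ℕ→ℚ-mono-< {0} {n} 1≤n
        0<g = 0<* 0<γ 0<n
        kg<d/2 = K·γN<d/2 0<α 0<n 0<c (0≤ℕ→ℚ k) [1+2k]c≡1 γ≤αc αn≤d
        open Component E oriented P I closed (d - g) g 0<g few-bad (λ l → <-≤-trans kg<d/2 (rows-half l))
    in (λ _ → twice-≤ {d - g} (union-≥-2D i∈I))
     , (λ ∣I∣≢1 → let (j , j∈I , j≢i) = ∃-other-element i∈I ∣I∣≢1 in
          nine-quarters-of-d-5g {d} {g} (<⇒≤ 0<g) (0≤ℕ→ℚ (unionSize P I)) (union-≥-9D/4 i∈I j∈I (j≢i ∘ sym)))
  where
  c : ℚ
  c = + 1 / suc (k ℕ.+ k)
  0<c : 0ℚ < c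
  0<c = positive⁻¹ c {{normalize-pos 1 (suc (k ℕ.+ k))}}
  [1+2k]c≡1 : (1ℚ + (ℕ→ℚ k + ℕ→ℚ k)) * c ≡ 1ℚ
  [1+2k]c≡1 = trans (cong (_* c) (sym (trans (ℕ→ℚ-+ 1 (k ℕ.+ k)) (cong (_+_ 1ℚ) (ℕ→ℚ-+ k k)))))
                    (ℕ→ℚ-*-inverse (k ℕ.+ k))
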